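{- Let $\mathbf E$ be a finite reading event model and let $\theta$ be a formula of $LD\preceq$ (containing no dynamic modalities). Then for every event $e\in E$ there is a formula $\theta_e$ of $LD\preceq$ such that $[e]\theta\leftrightarrow\theta_e$ is derivable in $\mathbf{LD\preceq E}$.
   Context: Fix a finite set $A$ of agents and atoms $Prop$. A reading event model is $\mathbf E=(E,(\sim_a)_{a\in A},\underline\bullet)$, $E$ finite, $\sim_a$ equivalence relations on $E$, each $e$ assigned $\underline e:A\to\mathcal P(A)$ with $a\in\underline e(a)$, and $e\sim_af$ implies $\underline e(a)=\underline f(a)$; $\underline e(B):=\bigcup_{b\in B}\underline e(b)$; $\sim_B:=\bigcap_{b\in B}\sim_b$ on $E$; $B\preceq^eC$ means: for all $f\in E$, $f\sim_Be$ implies $f\sim_Ce$. Language $LD\preceq E$: $\varphi::=p\mid\neg\varphi\mid\varphi\wedge\varphi\mid D_B\varphi\mid B\preceq C\mid[e]\varphi$ ($p\in Prop$, $B,C\subseteq A$, $e\in E$); $LD\preceq$ is its fragment without $[e]$. The system $\mathbf{LD\preceq E}$: classical propositional logic; for all $B,C,F\subseteq A$: from $\varphi$ infer $D_B\varphi$, $D_B(\varphi\to\psi)\to(D_B\varphi\to D_B\psi)$, $D_B\varphi\to\varphi$, $D_B\varphi\to D_BD_B\varphi$, $\neg D_B\varphi\to D_B\neg D_B\varphi$; $B\preceq C$ if $C\subseteq B$; $(B\preceq C\wedge B\preceq F)\to B\preceq C\cup F$; $(B\preceq C\wedge C\preceq F)\to B\preceq F$; $B\preceq C\to D_B(B\preceq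 C)$; $B\preceq C\to(D_C\varphi\to D_B\varphi)$; for each $e\in E$: from $\varphi$ infer $[e]\varphi$; $[e](\varphi\to\psi)\to([e]\varphi\to[e]\psi)$; $[e]p\leftrightarrow p$; $[e]\neg\varphi\leftrightarrow\neg[e]\varphi$; $[e](\varphi\wedge\psi)\leftrightarrow[e]\varphi\wedge[e]\psi$; $[e](B\preceq C)\leftrightarrow\underline e(B)\preceq\underline e(C)$ if $B\preceq^eC$; $[e](B\preceq C)\leftrightarrow\bot$ if not $B\preceq^eC$; $[e]D_B\varphi\leftrightarrow\bigwedge\{D_{\underline e(B)}[f]\varphi:f\sim_Be\}$. -}

module Defs where

open import Data.Nat using (ℕ; zero; suc)
open import Data.Fin using (Fin; zero; suc)
open import Data.Fin.Subset using (Subset; _∈_; _⊆_; _∪_)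
open import Data.Bool using (Bool; true; false; T; not; _∧_; _∨_)
open import Data.Vec using (tabulate; lookup)
import Data.Empty
open import Data.List using (List; []; _∷_; allFin; filterᵇ; map)
open import Relation.Binary.PropositionalEquality using (_≡_)

anyFin : {k : ℕ} → (Fin k → Bool) → Bool
anyFin {zero}  p = false
anyFin {suc k} p = p zero ∨ anyFin (λ i → p (suc i))

allFinᵇ : {k : ℕ} → (Fin k → Bool) → Bool
allFinᵇ {zero}  p = true
allFinᵇ {suc k} p = p zero ∧ allFinᵇ (λ i → p (suc i))

-- Agents A = Fin n.  A (finite) reading event model with event set E = Fin size.
-- The relations ∼_a are given as (decidable, i.e. Bool-valued) equivalence relations.
record EventModel (n : ℕ) : Set where
  field
    size   : ℕ
    rel    : Fin n → Fin size → Fin size → Bool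
    refl   : ∀ a e → T (rel a e e)
    sym    : ∀ a e f → T (rel a e f) → T (rel a f e)
    trans  : ∀ a e f g → T (rel a e f) → T (rel a f g) → T (rel a e g)
    read   : Fin size → Fin n → Subset n
    readSelf : ∀ e a → a ∈ read e a
    readUniform : ∀ a e f → T (rel a e f) → read e a ≡ read f a

module _ {n : ℕ} (𝐄 : EventModel n) where
  open EventModel 𝐄

  Ev : Set
  Ev = Fin size

  -- e(B) = ⋃_{b ∈ B} e(b)
  readSet : Ev → Subset n → Subset n
  readSet e B = tabulate (λ x → anyFin (λ b → lookup B b ∧ lookup (read e b) x))

  -- f ∼_B e  (∼_B = ⋂_{b∈B} ∼_b), boolean version
  simᵇ : Subset n → Ev → Ev → Bool
  simᵇ B f e = allFinᵇ (λ b → not (lookup B b) ∨ rel b f e)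

  Sim : Subset n → Ev → Ev → Set
  Sim B f e = ∀ b → b ∈ B → T (rel b f e)

  Prec : Ev → Subset n → Subset n → Set
  Prec e B C = ∀ f → Sim B f e → Sim C f e

  simList : Subset n → Ev → List Ev
  simList B e = filterᵇ (λ f → simᵇ B f e) (allFin size)

data Form₀ (n : ℕ) (P : Set) : Set where
  atom : P → Form₀ n P
  neg  : Form₀ n P → Form₀ n P
  and  : Form₀ n P → Form₀ n P → Form₀ n P
  D    : Subset n → Form₀ n P → Form₀ n P
  prec : Subset n → Subset n → Form₀ n P

module _ {n : ℕ} (P : Set) (𝐄 : EventModel n) where
  open EventModel 𝐄

  data Form : Set where
    atom : P → Form
    neg  : Form → Form
    and  : Form → Form → Form
    D    : Subset n → Form → Form
    prec : Subset n → Subset n → Form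
    box  : Fin size → Form → Form

module _ {n : ℕ} {P : Set} {𝐄 : EventModel n} where
  open EventModel 𝐄

  embed : Form₀ n P → Form P 𝐄
  embed (atom p) = atom p
  embed (neg φ) = neg (embed φ)
  embed (and φ ψ) = and (embed φ) (embed ψ)
  embed (D B φ) = D B (embed φ)
  embed (prec B C) = prec B C

  _⇒_ : Form P 𝐄 → Form P 𝐄 → Form P 𝐄
  φ ⇒ ψ = neg (and φ (neg ψ))

  _⇔_ : Form P 𝐄 → Form P 𝐄 → Form P 𝐄
  φ ⇔ ψ = and (φ ⇒ ψ) (ψ ⇒ φ)

  verum : Form P 𝐄
  verum = neg (and (prec Data.Fin.Subset.⊥ Data.Fin.Subset.⊥)
                   (neg (prec Data.Fin.Subset.⊥ Data.Fin.Subset.⊥)))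

  falsum : Form P 𝐄
  falsum = neg verum

  bigAnd : List (Form P 𝐄) → Form P 𝐄
  bigAnd [] = verum
  bigAnd (φ ∷ φs) = and φ (bigAnd φs)

  -- propositional evaluation treating non-Boolean subformulas as atoms
  evalP : (Form P 𝐄 → Bool) → Form P 𝐄 → Bool
  evalP v (neg φ) = not (evalP v φ)
  evalP v (and φ ψ) = evalP v φ ∧ evalP v ψ
  evalP v φ = v φ

  Taut : Form P 𝐄 → Set
  Taut φ = ∀ (v : Form P 𝐄 → Bool) → evalP v φ ≡ true

data ⊢ {n : ℕ} {P : Set} (𝐄 : EventModel n) : Form P 𝐄 → Set where
  taut : ∀ {φ} → Taut φ → ⊢ 𝐄 φ
  mp   : ∀ {φ ψ} → ⊢ 𝐄 (φ ⇒ ψ) → ⊢ 𝐄 φ → ⊢ 𝐄 ψ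
  necD : ∀ {B φ} → ⊢ 𝐄 φ → ⊢ 𝐄 (D B φ)
  kD   : ∀ {B φ ψ} → ⊢ 𝐄 (D B (φ ⇒ ψ) ⇒ (D B φ ⇒ D B ψ))
  tD   : ∀ {B φ} → ⊢ 𝐄 (D B φ ⇒ φ)
  4D   : ∀ {B φ} → ⊢ 𝐄 (D B φ ⇒ D B (D B φ))
  5D   : ∀ {B φ} → ⊢ 𝐄 (neg (D B φ) ⇒ D B (neg (D B φ)))
  precIncl  : ∀ {B C} → C ⊆ B → ⊢ 𝐄 (prec B C)
  precUnion : ∀ {B C F} → ⊢ 𝐄 (and (prec B C) (prec B F) ⇒ prec B (C ∪ F))
  precTrans : ∀ {B C F} → ⊢ 𝐄 (and (prec B C) (prec C F) ⇒ prec B F)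
  precKnow  : ∀ {B C} → ⊢ 𝐄 (prec B C ⇒ D B (prec B C))
  precD     : ∀ {B C φ} → ⊢ 𝐄 (prec B C ⇒ (D C φ ⇒ D B φ))
  necBox  : ∀ {e φ} → ⊢ 𝐄 φ → ⊢ 𝐄 (box e φ)
  kBox    : ∀ {e φ ψ} → ⊢ 𝐄 (box e (φ ⇒ ψ) ⇒ (box e φ ⇒ box e ψ))
  boxAtom : ∀ {e p} → ⊢ 𝐄 (box e (atom p) ⇔ atom p)
  boxNeg  : ∀ {e φ} → ⊢ 𝐄 (box e (neg φ) ⇔ neg (box e φ))
  boxAnd  : ∀ {e φ ψ} → ⊢ 𝐄 (box e (and φ ψ) ⇔ and (box e φ) (box e ψ))
  boxPrec : ∀ {e B C} → Prec 𝐄 e B C →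
            ⊢ 𝐄 (box e (prec B C) ⇔ prec (readSet 𝐄 e B) (readSet 𝐄 e C))
  boxPrecNot : ∀ {e B C} → (Prec 𝐄 e B C → Data.Empty.⊥) →
            ⊢ 𝐄 (box e (prec B C) ⇔ falsum)
  boxD    : ∀ {e B φ} →
            ⊢ 𝐄 (box e (D B φ) ⇔
                 bigAnd (map (λ f → D (readSet 𝐄 e B) (box f φ)) (simList 𝐄 B e)))

-- The reduction axioms rewrite [e] applied to any static connective into static connectives
-- applied to formulas [f]θ' with θ' a proper subformula; so the translation is defined by
-- recursion on θ, simultaneously for all events, and each clause is justified by one
-- reduction axiom together with replacement of provable equivalents under ¬, ∧, D_B and ⋀.
module Submission where

open import Defs
open import Data.Nat using (ℕ)
open import Data.Fin using (Fin)
open import Data.Product using (∃-syntax; _,_)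
open import Data.Bool using (Bool; true; false; not; _∧_; T?)
open import Data.List using (List; []; _∷_; map)
import Data.Fin.Subset as S
open import Data.Fin.Subset.Properties using (_∈?_)
open import Data.Fin.Properties using (all?)
open import Relation.Nullary using (Dec; yes; no)
open import Relation.Nullary.Decidable using (_→-dec_)
open import Relation.Binary.PropositionalEquality using (_≡_; refl)

-- evalP v (φ ⇒ ψ) computes to evalP v φ ⇒ᵇ evalP v ψ, so each derived rule below is a truth table.
_⇒ᵇ_ : Bool → Bool → Bool
a ⇒ᵇ b = not (a ∧ not b)

_⇔ᵇ_ : Bool → Bool → Bool
a ⇔ᵇ b = (a ⇒ᵇ b) ∧ (b ⇒ᵇ a)

⇔ᵇ-refl : ∀ a → (a ⇔ᵇ a) ≡ true
⇔ᵇ-refl true  = refl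
⇔ᵇ-refl false = refl

⇔ᵇ-elimʳ : ∀ a b → ((a ⇔ᵇ b) ⇒ᵇ (a ⇒ᵇ b)) ≡ true
⇔ᵇ-elimʳ true  true  = refl
⇔ᵇ-elimʳ true  false = refl
⇔ᵇ-elimʳ false true  = refl
⇔ᵇ-elimʳ false false = refl

⇔ᵇ-elimˡ : ∀ a b → ((a ⇔ᵇ b) ⇒ᵇ (b ⇒ᵇ a)) ≡ true
⇔ᵇ-elimˡ true  true  = refl
⇔ᵇ-elimˡ true  false = refl
⇔ᵇ-elimˡ false true  = refl
⇔ᵇ-elimˡ false false = refl

⇔ᵇ-intro : ∀ a b → ((a ⇒ᵇ b) ⇒ᵇ ((b ⇒ᵇ a) ⇒ᵇ (a ⇔ᵇ b))) ≡ true
⇔ᵇ-intro true  true  = refl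
⇔ᵇ-intro true  false = refl
⇔ᵇ-intro false true  = refl
⇔ᵇ-intro false false = refl

⇔ᵇ-trans : ∀ a b c → ((a ⇔ᵇ b) ⇒ᵇ ((b ⇔ᵇ c) ⇒ᵇ (a ⇔ᵇ c))) ≡ true
⇔ᵇ-trans true  true  true  = refl
⇔ᵇ-trans true  true  false = refl
⇔ᵇ-trans true  false true  = refl
⇔ᵇ-trans true  false false = refl
⇔ᵇ-trans false true  true  = refl
⇔ᵇ-trans false true  false = refl
⇔ᵇ-trans false false true  = refl
⇔ᵇ-trans false false false = refl

not-cong-⇔ᵇ : ∀ a b → ((a ⇔ᵇ b) ⇒ᵇ (not a ⇔ᵇ not b)) ≡ true
not-cong-⇔ᵇ true  true  = refl
not-cong-⇔ᵇ true  false = refl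
not-cong-⇔ᵇ false true  = refl
not-cong-⇔ᵇ false false = refl

∧-cong-⇔ᵇ : ∀ a b c d → ((a ⇔ᵇ b) ⇒ᵇ ((c ⇔ᵇ d) ⇒ᵇ ((a ∧ c) ⇔ᵇ (b ∧ d)))) ≡ true
∧-cong-⇔ᵇ true  true  true  true  = refl
∧-cong-⇔ᵇ true  true  true  false = refl
∧-cong-⇔ᵇ true  true  false true  = refl
∧-cong-⇔ᵇ true  true  false false = refl
∧-cong-⇔ᵇ true  false true  true  = refl
∧-cong-⇔ᵇ true  false true  false = refl
∧-cong-⇔ᵇ true  false false true  = refl
∧-cong-⇔ᵇ true  false false false = refl
∧-cong-⇔ᵇ false true  true  true  = refl
∧-cong-⇔ᵇ false true  true  false = refl
∧-cong-⇔ᵇ false true  false true  = refl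
∧-cong-⇔ᵇ false true  false false = refl
∧-cong-⇔ᵇ false false true  true  = refl
∧-cong-⇔ᵇ false false true  false = refl
∧-cong-⇔ᵇ false false false true  = refl
∧-cong-⇔ᵇ false false false false = refl

module DerivedRules {n : ℕ} {P : Set} {𝐄 : EventModel n} where

  mp₂ : ∀ {φ ψ χ : Form P 𝐄} → ⊢ 𝐄 (φ ⇒ (ψ ⇒ χ)) → ⊢ 𝐄 φ → ⊢ 𝐄 ψ → ⊢ 𝐄 χ
  mp₂ h x y = mp (mp h x) y

  ⇔-refl : ∀ {φ : Form P 𝐄} → ⊢ 𝐄 (φ ⇔ φ)
  ⇔-refl {φ} = taut λ v → ⇔ᵇ-refl (evalP v φ)

  ⇔-elimʳ : ∀ {φ ψ : Form P 𝐄} → ⊢ 𝐄 (φ ⇔ ψ) → ⊢ 𝐄 (φ ⇒ ψ)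
  ⇔-elimʳ {φ} {ψ} = mp (taut λ v → ⇔ᵇ-elimʳ (evalP v φ) (evalP v ψ))

  ⇔-elimˡ : ∀ {φ ψ : Form P 𝐄} → ⊢ 𝐄 (φ ⇔ ψ) → ⊢ 𝐄 (ψ ⇒ φ)
  ⇔-elimˡ {φ} {ψ} = mp (taut λ v → ⇔ᵇ-elimˡ (evalP v φ) (evalP v ψ))

  ⇔-intro : ∀ {φ ψ : Form P 𝐄} → ⊢ 𝐄 (φ ⇒ ψ) → ⊢ 𝐄 (ψ ⇒ φ) → ⊢ 𝐄 (φ ⇔ ψ)
  ⇔-intro {φ} {ψ} = mp₂ (taut λ v → ⇔ᵇ-intro (evalP v φ) (evalP v ψ))

  ⇔-trans : ∀ {φ ψ χ : Form P 𝐄} → ⊢ 𝐄 (φ ⇔ ψ) → ⊢ 𝐄 (ψ ⇔ χ) → ⊢ 𝐄 (φ ⇔ χ)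
  ⇔-trans {φ} {ψ} {χ} = mp₂ (taut λ v → ⇔ᵇ-trans (evalP v φ) (evalP v ψ) (evalP v χ))

  neg-cong : ∀ {φ ψ : Form P 𝐄} → ⊢ 𝐄 (φ ⇔ ψ) → ⊢ 𝐄 (neg φ ⇔ neg ψ)
  neg-cong {φ} {ψ} = mp (taut λ v → not-cong-⇔ᵇ (evalP v φ) (evalP v ψ))

  and-cong : ∀ {φ φ′ ψ ψ′ : Form P 𝐄} →
             ⊢ 𝐄 (φ ⇔ φ′) → ⊢ 𝐄 (ψ ⇔ ψ′) → ⊢ 𝐄 (and φ ψ ⇔ and φ′ ψ′)
  and-cong {φ} {φ′} {ψ} {ψ′} =
    mp₂ (taut λ v → ∧-cong-⇔ᵇ (evalP v φ) (evalP v φ′) (evalP v ψ) (evalP v ψ′))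

  D-mono : ∀ {B} {φ ψ : Form P 𝐄} → ⊢ 𝐄 (φ ⇒ ψ) → ⊢ 𝐄 (D B φ ⇒ D B ψ)
  D-mono h = mp kD (necD h)

  D-cong : ∀ {B} {φ ψ : Form P 𝐄} → ⊢ 𝐄 (φ ⇔ ψ) → ⊢ 𝐄 (D B φ ⇔ D B ψ)
  D-cong h = ⇔-intro (D-mono (⇔-elimʳ h)) (D-mono (⇔-elimˡ h))

open DerivedRules

module _ {n : ℕ} {P : Set} where

  verum₀ : Form₀ n P
  verum₀ = neg (and (prec S.⊥ S.⊥) (neg (prec S.⊥ S.⊥)))

  falsum₀ : Form₀ n P
  falsum₀ = neg verum₀

  bigAnd₀ : List (Form₀ n P) → Form₀ n P
  bigAnd₀ []       = verum₀
  bigAnd₀ (φ ∷ φs) = and φ (bigAnd₀ φs)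

  bigAnd-cong-embed : ∀ {𝐄 : EventModel n} {X : Set} (φ : X → Form P 𝐄) (ψ : X → Form₀ n P) →
                      (∀ x → ⊢ 𝐄 (φ x ⇔ embed (ψ x))) →
                      (xs : List X) → ⊢ 𝐄 (bigAnd (map φ xs) ⇔ embed (bigAnd₀ (map ψ xs)))
  bigAnd-cong-embed φ ψ h []       = ⇔-refl
  bigAnd-cong-embed φ ψ h (x ∷ xs) = and-cong (h x) (bigAnd-cong-embed φ ψ h xs)

module _ {n : ℕ} (𝐄 : EventModel n) where
  open EventModel 𝐄

  Sim? : ∀ B f e → Dec (Sim 𝐄 B f e)
  Sim? B f e = all? λ b → (b ∈? B) →-dec T? (rel b f e)

  Prec? : ∀ e B C → Dec (Prec 𝐄 e B C)
  Prec? e B C = all? λ f → Sim? B f e →-dec Sim? C f e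

module Reduction {n : ℕ} {P : Set} (𝐄 : EventModel n) where
  open EventModel 𝐄

  precReduct : ∀ {e B C} → Dec (Prec 𝐄 e B C) → Form₀ n P
  precReduct {e} {B} {C} (yes _) = prec (readSet 𝐄 e B) (readSet 𝐄 e C)
  precReduct             (no _)  = falsum₀

  reduce : Ev 𝐄 → Form₀ n P → Form₀ n P
  reduce e (atom p)   = atom p
  reduce e (neg θ)    = neg (reduce e θ)
  reduce e (and θ θ′) = and (reduce e θ) (reduce e θ′)
  reduce e (prec B C) = precReduct (Prec? 𝐄 e B C)
  reduce e (D B θ)    = bigAnd₀ (map (λ f → D (readSet 𝐄 e B) (reduce f θ)) (simList 𝐄 B e))

  box-prec-reduct : ∀ {e B C} (d : Dec (Prec 𝐄 e B C)) →
                    ⊢ 𝐄 (box e (prec B C) ⇔ embed (precReduct d))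
  box-prec-reduct (yes p) = boxPrec p
  box-prec-reduct (no ¬p) = boxPrecNot ¬p

  box-reduce : ∀ e θ → ⊢ 𝐄 (box e (embed θ) ⇔ embed (reduce e θ))
  box-reduce e (atom p)   = boxAtom
  box-reduce e (neg θ)    = ⇔-trans boxNeg (neg-cong (box-reduce e θ))
  box-reduce e (and θ θ′) = ⇔-trans boxAnd (and-cong (box-reduce e θ) (box-reduce e θ′))
  box-reduce e (prec B C) = box-prec-reduct (Prec? 𝐄 e B C)
  box-reduce e (D B θ) =
    ⇔-trans boxD (bigAnd-cong-embed _ _ (λ f → D-cong (box-reduce f θ)) (simList 𝐄 B e))

lemma7 : {n : ℕ} {P : Set} (𝐄 : EventModel n) (θ : Form₀ n P)
         (e : Fin (EventModel.size 𝐄)) →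
         ∃[ θₑ ] ⊢ 𝐄 (box e (embed θ) ⇔ embed θₑ)
lemma7 𝐄 θ e = Reduction.reduce 𝐄 e θ , Reduction.box-reduce 𝐄 e θ
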